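{- Let $e$ be a normal expression of the split fireball calculus and let $\pi\triangleright\Gamma\vdash e:\mathbf 0$ be a tight derivation. Then $|e|=|\Gamma|$.
   Context: Terms: $t,u ::= x \mid \lambda x.t \mid tu$, up to $\alpha$-equivalence; $t\{x\leftarrow u\}$ is capture-avoiding substitution. Values: $v ::= x \mid \lambda x.t$. Fireballs $f$ and inert terms $i$ are defined by mutual induction: $f ::= v \mid i$ and $i ::= x f_1 \dots f_n$ with $n>0$ (application left-associative). Right evaluation contexts: $C ::= \langle\cdot\rangle \mid t\,C \mid C\,f$. Split fireball calculus: environments $E ::= \epsilon \mid [x\leftarrow i]:E$; programs $p=(t,E)$; expressions are terms or programs. Reduction: $(C\langle(\lambda x.t)v\rangle,E)\to_{\beta_v}(C\langle t\{x\leftarrow v\}\rangle,E)$ and $(C\langle(\lambda x.t)i\rangle,E)\to_{\beta_i}(C\langle t\rangle,[x\leftarrow i]:E)$; $\to_{\beta_f}=\to_{\beta_v}\cup\to_{\beta_i}$. A program is normal if it has no $\to_{\beta_f}$-reduct; a normal expression is a normal program or a term $t$ such that $(t,E)$ is normal for every environment $E$. Append: $\epsilon@[x\leftarrow i]=[x\leftarrow i]$, $([y\leftarrow i']:E)@[x\leftarrow i]=[y\leftarrow i']:(E@[x\leftarrow i])$. Sizes: $|v|=0$, $|tu|=|t|+|u|+1$, $|(t,\epsilon)|=|t|$, $|(t,E@[x\leftarrow i])|=|(t,E)|+|i|$. Multi types: linear types $L ::= M\multimap N$; multi types $M,N ::= [L_1,\dots,L_n]$ (finite multisets, $n\ge 0$);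 $\mathbf 0$ empty multiset, $\uplus$ multiset sum. Type context $\Gamma$: total map from variables to multi types with finite $\mathrm{dom}(\Gamma)=\{x\mid \Gamma(x)\ne\mathbf 0\}$; $(\Gamma\uplus\Delta)(x)=\Gamma(x)\uplus\Delta(x)$; $x:M$ maps $x$ to $M$ and all else to $\mathbf 0$; $\Gamma,x:M$ extends $\Gamma$ ($x\notin\mathrm{dom}(\Gamma)$) by $x\mapsto M$. Typing rules: (ax) $x:M\vdash x:M$; (@) from $\Gamma\vdash t:[M\multimap N]$ and $\Delta\vdash u:M$ infer $\Gamma\uplus\Delta\vdash tu:N$; ($\lambda$) from $\Gamma_k,x:M_k\vdash t:N_k$ for $k=1,\dots,n$ ($n\ge0$) infer $\Gamma_1\uplus\dots\uplus\Gamma_n\vdash\lambda x.t:[M_1\multimap N_1,\dots,M_n\multimap N_n]$; (es$_\epsilon$) from $\Gamma\vdash t:M$ infer $\Gamma\vdash (t,\epsilon):M$; (es$_@$) from $\Gamma,x:M\vdash(t,E):N$ and $\Delta\vdash i:M$ infer $\Gamma\uplus\Delta\vdash(t,E@[x\leftarrow i]):N$. Type sizes: $|M\multimap N|=1+|M|+|N|$, $|[L_1,\dots,L_n]|=\sum_k|L_k|$, $|\Gamma|=\sum_x|\Gamma(x)|$. Inert multi types: finite multisets of linear types $\mathbf 0\multimap N$ with $N$ inert (inductively; $\mathbf 0$ is inert); a context is inert if all its values are inert. A derivation $\pi\triangleright\Gamma\vdash e:M$ is inert if $\Gamma$ and $M$ are inert, and tight if it is inert and $M=\mathbf 0$. 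-}

module Defs where

open import Data.Nat using (ℕ; zero; suc; _+_; _⊔_; _≡ᵇ_)
open import Data.Bool using (Bool; true; false; if_then_else_; not)
open import Data.List using (List; []; _∷_; _++_; [_]; concat; concatMap; map; filter; foldr)
open import Data.List.Relation.Unary.All using (All)
open import Data.List.Relation.Binary.Permutation.Homogeneous using (Permutation)
open import Data.Product using (Σ; ∃; _×_; _,_; proj₁; proj₂)
open import Relation.Nullary using (¬_)
open import Relation.Nullary.Decidable using (¬?)
open import Data.Nat.Properties using (_≟_)

Var : Set
Var = ℕ

data Term : Set where
  var : Var → Term
  lam : Var → Term → Term
  app : Term → Term → Term

data Val : Term → Set where
  val-var : ∀ {x} → Val (var x)
  val-lam : ∀ {x t} → Val (lam x t)

mutual
  data Fireball : Term → Set where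
    fb-val   : ∀ {t} → Val t → Fireball t
    fb-inert : ∀ {t} → Inert t → Fireball t

  -- i ::= x f₁ … fₙ  (n > 0, left-associated application)
  data Inert : Term → Set where
    inert-var : ∀ {x f} → Fireball f → Inert (app (var x) f)
    inert-app : ∀ {i f} → Inert i → Fireball f → Inert (app i f)

fv : Term → List Var
fv (var x)   = [ x ]
fv (lam x t) = filter (λ y → ¬? (y ≟ x)) (fv t)
fv (app t u) = fv t ++ fv u

fresh : List Var → Var
fresh xs = suc (foldr _⊔_ 0 xs)

ssubst : (Var → Term) → Term → Term
ssubst σ (var x)   = σ x
ssubst σ (app t u) = app (ssubst σ t) (ssubst σ u)
ssubst σ (lam x t) = lam y (ssubst (λ z → if z ≡ᵇ x then var y else σ z) t)
  where y = fresh (concatMap (λ z → fv (σ z)) (fv (lam x t)))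

_[_≔_] : Term → Var → Term → Term
t [ x ≔ u ] = ssubst (λ z → if z ≡ᵇ x then u else var z) t

size : Term → ℕ
size (var x)   = 0
size (lam x t) = 0
size (app t u) = size t + size u + 1

data ECtx : Set where
  hole : ECtx
  appL : Term → ECtx → ECtx
  appR : ECtx → (f : Term) → Fireball f → ECtx

plug : ECtx → Term → Term
plug hole         s = s
plug (appL t C)   s = app t (plug C s)
plug (appR C f _) s = app (plug C s) f

data Env : Set where
  ε     : Env
  [_←_∣_]∷_ : (x : Var) (i : Term) → Inert i → Env → Env

_＠[_←_∣_] : Env → (x : Var) (i : Term) → Inert i → Env
ε ＠[ x ← i ∣ p ] = [ x ← i ∣ p ]∷ ε
([ y ← i′ ∣ q ]∷ E) ＠[ x ← i ∣ p ] = [ y ← i′ ∣ q ]∷ (E ＠[ x ← i ∣ p ])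

Program : Set
Program = Term × Env

data _→βf_ : Program → Program → Set where
  βv : ∀ {C x t v E} → Val v →
       (plug C (app (lam x t) v) , E) →βf (plug C (t [ x ≔ v ]) , E)
  βi : ∀ {C x t i E} (p : Inert i) →
       (plug C (app (lam x t) i) , E) →βf (plug C t , [ x ← i ∣ p ]∷ E)

NormalProgram : Program → Set
NormalProgram p = ¬ (∃ λ p′ → p →βf p′)

data Expr : Set where
  term : Term → Expr
  prog : Program → Expr

NormalExpr : Expr → Set
NormalExpr (term t) = ∀ (E : Env) → NormalProgram (t , E)
NormalExpr (prog p) = NormalProgram p

-- sizes: |(t, ε)| = |t|, |(t, E @ [x←i])| = |(t,E)| + |i|
sizeEnv : Env → ℕ
sizeEnv ε                 = 0
sizeEnv ([ x ← i ∣ _ ]∷ E) = size i + sizeEnv E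

sizeProg : Program → ℕ
sizeProg (t , E) = size t + sizeEnv E

sizeExpr : Expr → ℕ
sizeExpr (term t) = size t
sizeExpr (prog p) = sizeProg p

-- Multi types (multisets represented by lists, compared up to ≈)

data LType : Set where
  _⊸_ : List LType → List LType → LType

MType : Set
MType = List LType

𝟎 : MType
𝟎 = []

data _≈L_ : LType → LType → Set where
  ⊸-cong : ∀ {M M′ N N′} → Permutation _≈L_ M M′ → Permutation _≈L_ N N′ →
           (M ⊸ N) ≈L (M′ ⊸ N′)

_≈M_ : MType → MType → Set
M ≈M N = Permutation _≈L_ M N

mutual
  sizeL : LType → ℕ
  sizeL (M ⊸ N) = suc (sizeM M + sizeM N)

  sizeM : MType → ℕ
  sizeM []       = 0
  sizeM (L ∷ Ls) = sizeL L + sizeM Ls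

-- Type contexts: finite-support total maps Var → MType, represented as
-- association lists; Γ(x) is the multiset sum of all entries for x,
-- ⊎ is concatenation, x:M is [ (x , M) ].
TCtx : Set
TCtx = List (Var × MType)

_⟨_⟩ : TCtx → Var → MType
Γ ⟨ x ⟩ = concatMap (λ e → if proj₁ e ≡ᵇ x then proj₂ e else []) Γ

-- Γ with x mapped to 𝟎 (so that Θ = (Θ ∖ x) , x : Θ⟨x⟩)
_∖_ : TCtx → Var → TCtx
Γ ∖ x = filter (λ e → ¬? (proj₁ e ≟ x)) Γ

sizeCtx : TCtx → ℕ
sizeCtx []             = 0
sizeCtx ((x , M) ∷ Γ) = sizeM M + sizeCtx Γ

data _⊢_∶_ : TCtx → Term → MType → Set where
  ax  : ∀ {x M} → [ (x , M) ] ⊢ var x ∶ M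
  app-rule : ∀ {Γ Δ t u M M′ N} →
        Γ ⊢ t ∶ [ M ⊸ N ] → Δ ⊢ u ∶ M′ → M ≈M M′ →
        (Γ ++ Δ) ⊢ app t u ∶ N
  -- premises Γₖ , x : Mₖ ⊢ t : Nₖ, written as Θₖ ⊢ t : Nₖ
  -- with Γₖ = Θₖ ∖ x and Mₖ = Θₖ⟨x⟩
  λ-rule : ∀ {x t} (ps : List (TCtx × MType)) →
        All (λ p → proj₁ p ⊢ t ∶ proj₂ p) ps →
        concat (map (λ p → proj₁ p ∖ x) ps) ⊢ lam x t ∶
          map (λ p → (proj₁ p ⟨ x ⟩) ⊸ proj₂ p) ps

data _⊢ₚ_∶_ : TCtx → Program → MType → Set where
  es-ε : ∀ {Γ t M} → Γ ⊢ t ∶ M → Γ ⊢ₚ (t , ε) ∶ M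
  -- premise Γ , x : M ⊢ (t,E) : N written as Θ ⊢ (t,E) : N
  es-app : ∀ {Θ Δ t E x i M N} (p : Inert i) →
        Θ ⊢ₚ (t , E) ∶ N → Δ ⊢ i ∶ M → M ≈M (Θ ⟨ x ⟩) →
        ((Θ ∖ x) ++ Δ) ⊢ₚ (t , E ＠[ x ← i ∣ p ]) ∶ N

_⊢ₑ_∶_ : TCtx → Expr → MType → Set
Γ ⊢ₑ term t ∶ M = Γ ⊢ t ∶ M
Γ ⊢ₑ prog p ∶ M = Γ ⊢ₚ p ∶ M

data InertL : LType → Set where
  inertL : ∀ {N} → All InertL N → InertL (𝟎 ⊸ N)

InertM : MType → Set
InertM = All InertL

InertCtx : TCtx → Set
InertCtx Γ = All (λ e → InertM (proj₂ e)) Γ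

-- A normal term is a fireball. With an inert context, an inert term x f₁ … fₙ gets an
-- inert type, and its head x must have type [𝟎 ⊸ … [𝟎 ⊸ N]]: one arrow per application
-- node, while each argument fⱼ is then tight. Tight values need an empty context, so
-- the context size counts application nodes, i.e. |Γ| = |i| + |N|. An explicit
-- substitution [x ← i] trades the type of x in the context for the typing of i.
module Submission where

open import Defs
open import Relation.Binary.PropositionalEquality
  using (_≡_; refl; sym; trans; cong; cong₂; module ≡-Reasoning)
open import Data.Nat using (suc; _+_; _≡ᵇ_)
open import Data.Nat.Properties using (+-assoc; +-comm; +-identityʳ; +-commutativeSemigroup)
open import Algebra.Properties.CommutativeSemigroup +-commutativeSemigroup
  using (x∙yz≈y∙xz; xy∙z≈x∙zy)
open import Data.Nat.Solver using (module +-*-Solver)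
open +-*-Solver using (solve; _:+_; con; _:=_)
open import Data.Bool using (true; false)
open import Data.List using ([]; _∷_; _++_; [_])
open import Data.List.Relation.Unary.All using ([]; _∷_)
open import Data.List.Relation.Unary.All.Properties using (++⁻)
open import Data.List.Relation.Binary.Pointwise.Base using (Pointwise; []; _∷_)
open import Data.List.Relation.Binary.Permutation.Homogeneous
  using (prep; swap) renaming (refl to ≈M-refl; trans to ≈M-trans)
open import Data.Product using (_,_)
open import Data.Sum using (_⊎_; inj₁; inj₂)
open import Data.Empty using (⊥-elim)

𝟎≈M⇒≡𝟎 : ∀ {M} → 𝟎 ≈M M → M ≡ 𝟎
𝟎≈M⇒≡𝟎 (≈M-refl []) = refl
𝟎≈M⇒≡𝟎 (≈M-trans p q) with 𝟎≈M⇒≡𝟎 p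
... | refl = 𝟎≈M⇒≡𝟎 q

sizeM-++ : ∀ M N → sizeM (M ++ N) ≡ sizeM M + sizeM N
sizeM-++ []      N = refl
sizeM-++ (L ∷ M) N = trans (cong (sizeL L +_) (sizeM-++ M N)) (sym (+-assoc (sizeL L) _ _))

sizeCtx-++ : ∀ Γ Δ → sizeCtx (Γ ++ Δ) ≡ sizeCtx Γ + sizeCtx Δ
sizeCtx-++ []            Δ = refl
sizeCtx-++ ((x , M) ∷ Γ) Δ = trans (cong (sizeM M +_) (sizeCtx-++ Γ Δ)) (sym (+-assoc (sizeM M) _ _))

mutual
  sizeL-≈ : ∀ {L L′} → L ≈L L′ → sizeL L ≡ sizeL L′
  sizeL-≈ (⊸-cong p q) = cong suc (cong₂ _+_ (sizeM-≈ p) (sizeM-≈ q))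

  sizeM-≈ : ∀ {M M′} → M ≈M M′ → sizeM M ≡ sizeM M′
  sizeM-≈ (≈M-refl ps)    = sizeM-pointwise ps
  sizeM-≈ (prep e p)       = cong₂ _+_ (sizeL-≈ e) (sizeM-≈ p)
  sizeM-≈ (swap {xs} {ys} {x} {y} {x′} {y′} e₁ e₂ p) = begin
    sizeL x + (sizeL y + sizeM xs)     ≡⟨ cong₂ _+_ (sizeL-≈ e₁) (cong₂ _+_ (sizeL-≈ e₂) (sizeM-≈ p)) ⟩
    sizeL x′ + (sizeL y′ + sizeM ys)   ≡⟨ x∙yz≈y∙xz (sizeL x′) (sizeL y′) (sizeM ys) ⟩
    sizeL y′ + (sizeL x′ + sizeM ys)   ∎
    where open ≡-Reasoning
  sizeM-≈ (≈M-trans p q)   = trans (sizeM-≈ p) (sizeM-≈ q)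

  sizeM-pointwise : ∀ {M M′} → Pointwise _≈L_ M M′ → sizeM M ≡ sizeM M′
  sizeM-pointwise []       = refl
  sizeM-pointwise (e ∷ ps) = cong₂ _+_ (sizeL-≈ e) (sizeM-pointwise ps)

mutual
  inertL-≈ : ∀ {L L′} → L ≈L L′ → InertL L → InertL L′
  inertL-≈ (⊸-cong p q) (inertL iN) with 𝟎≈M⇒≡𝟎 p
  ... | refl = inertL (inertM-≈ q iN)

  inertM-≈ : ∀ {M M′} → M ≈M M′ → InertM M → InertM M′
  inertM-≈ (≈M-refl ps)   iM             = inertM-pointwise ps iM
  inertM-≈ (prep e p)      (iL ∷ iM)      = inertL-≈ e iL ∷ inertM-≈ p iM
  inertM-≈ (swap e₁ e₂ p)  (iL ∷ iL′ ∷ iM) = inertL-≈ e₂ iL′ ∷ inertL-≈ e₁ iL ∷ inertM-≈ p iM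
  inertM-≈ (≈M-trans p q)  iM             = inertM-≈ q (inertM-≈ p iM)

  inertM-pointwise : ∀ {M M′} → Pointwise _≈L_ M M′ → InertM M → InertM M′
  inertM-pointwise []       iM        = iM
  inertM-pointwise (e ∷ ps) (iL ∷ iM) = inertL-≈ e iL ∷ inertM-pointwise ps iM

sizeCtx-∖-⟨⟩ : ∀ Θ x → sizeCtx Θ ≡ sizeCtx (Θ ∖ x) + sizeM (Θ ⟨ x ⟩)
sizeCtx-∖-⟨⟩ []            x = refl
sizeCtx-∖-⟨⟩ ((y , M) ∷ Θ) x with y ≡ᵇ x
... | true = begin
  sizeM M + sizeCtx Θ                                  ≡⟨ cong (sizeM M +_) (sizeCtx-∖-⟨⟩ Θ x) ⟩
  sizeM M + (sizeCtx (Θ ∖ x) + sizeM (Θ ⟨ x ⟩))        ≡⟨ x∙yz≈y∙xz (sizeM M) (sizeCtx (Θ ∖ x)) _ ⟩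
  sizeCtx (Θ ∖ x) + (sizeM M + sizeM (Θ ⟨ x ⟩))        ≡⟨ cong (sizeCtx (Θ ∖ x) +_) (sym (sizeM-++ M _)) ⟩
  sizeCtx (Θ ∖ x) + sizeM (M ++ Θ ⟨ x ⟩)               ∎
  where open ≡-Reasoning
... | false = trans (cong (sizeM M +_) (sizeCtx-∖-⟨⟩ Θ x)) (sym (+-assoc (sizeM M) _ _))

inertCtx-∖-⟨⟩ : ∀ Θ x → InertCtx (Θ ∖ x) → InertM (Θ ⟨ x ⟩) → InertCtx Θ
inertCtx-∖-⟨⟩ []            x _ _ = []
inertCtx-∖-⟨⟩ ((y , M) ∷ Θ) x iΘ iΘx with y ≡ᵇ x
... | true with ++⁻ M iΘx
...   | iM , iΘx′ = iM ∷ inertCtx-∖-⟨⟩ Θ x iΘ iΘx′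
inertCtx-∖-⟨⟩ ((y , M) ∷ Θ) x (iM ∷ iΘ) iΘx | false = iM ∷ inertCtx-∖-⟨⟩ Θ x iΘ iΘx

lam-𝟎⇒ctx-[] : ∀ {Γ x t M} → Γ ⊢ lam x t ∶ M → M ≡ 𝟎 → Γ ≡ []
lam-𝟎⇒ctx-[] (λ-rule []      _) _  = refl
lam-𝟎⇒ctx-[] (λ-rule (_ ∷ _) _) ()

record Balanced (Γ : TCtx) (t : Term) (M : MType) : Set where
  constructor balanced
  field
    inert-type : InertM M
    sizeCtx≡   : sizeCtx Γ ≡ size t + sizeM M

var-balanced : ∀ {x M} → InertCtx [ (x , M) ] → Balanced [ (x , M) ] (var x) M
var-balanced (iM ∷ []) = balanced iM (+-identityʳ _)

mutual
  app-balanced : ∀ {Γ Δ t u M M′ N} → Fireball u →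
    Balanced Γ t [ M ⊸ N ] → Δ ⊢ u ∶ M′ → M ≈M M′ → InertCtx Δ →
    Balanced (Γ ++ Δ) (app t u) N
  app-balanced {Γ} {Δ} {t} {u} {N = N} fu (balanced (inertL iN ∷ []) Γ≡) du 𝟎≈M′ iΔ
    with 𝟎≈M⇒≡𝟎 𝟎≈M′
  ... | refl = balanced iN (begin
    sizeCtx (Γ ++ Δ)                     ≡⟨ sizeCtx-++ Γ Δ ⟩
    sizeCtx Γ + sizeCtx Δ                ≡⟨ cong₂ _+_ Γ≡ (tight-fireball-size fu du iΔ) ⟩
    size t + (suc (sizeM N) + 0) + size u
      ≡⟨ solve 3 (λ t N u → t :+ (con 1 :+ N :+ con 0) :+ u := t :+ u :+ con 1 :+ N) refl
               (size t) (sizeM N) (size u) ⟩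
    size t + size u + 1 + sizeM N         ∎)
    where open ≡-Reasoning

  inert-balanced : ∀ {Γ i M} → Inert i → Γ ⊢ i ∶ M → InertCtx Γ → Balanced Γ i M
  inert-balanced (inert-var fu) (app-rule ax du M≈M′) (iM ∷ iΔ) =
    app-balanced fu (var-balanced (iM ∷ [])) du M≈M′ iΔ
  inert-balanced (inert-app ii fu) (app-rule {Γ = Γ} di du M≈M′) iΓΔ
    with ++⁻ Γ iΓΔ
  ... | iΓ , iΔ = app-balanced fu (inert-balanced ii di iΓ) du M≈M′ iΔ

  tight-fireball-size : ∀ {Γ f} → Fireball f → Γ ⊢ f ∶ 𝟎 → InertCtx Γ → sizeCtx Γ ≡ size f
  tight-fireball-size (fb-val val-var) ax _ = refl
  tight-fireball-size (fb-val val-lam) d  _ with lam-𝟎⇒ctx-[] d refl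
  ... | refl = refl
  tight-fireball-size (fb-inert ii) d iΓ =
    trans (Balanced.sizeCtx≡ (inert-balanced ii d iΓ)) (+-identityʳ _)

sizeEnv-＠ : ∀ E x i (p : Inert i) → sizeEnv (E ＠[ x ← i ∣ p ]) ≡ sizeEnv E + size i
sizeEnv-＠ ε                  x i p = +-comm (size i) 0
sizeEnv-＠ ([ y ← i′ ∣ q ]∷ E) x i p =
  trans (cong (size i′ +_) (sizeEnv-＠ E x i p)) (sym (+-assoc (size i′) _ _))

tight-program-size : ∀ {Γ t E} → Fireball t → Γ ⊢ₚ (t , E) ∶ 𝟎 → InertCtx Γ →
  sizeProg (t , E) ≡ sizeCtx Γ
tight-program-size ft (es-ε d) iΓ = trans (+-identityʳ _) (sym (tight-fireball-size ft d iΓ))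
tight-program-size {t = t} ft (es-app {Θ} {Δ} {E = E} {x} {i} {M} p d di M≈Θx) iΓ
  with ++⁻ (Θ ∖ x) iΓ
... | iΘ∖x , iΔ with inert-balanced p di iΔ
... | balanced iM Δ≡ = begin
  size t + sizeEnv (E ＠[ x ← i ∣ p ])        ≡⟨ cong (size t +_) (sizeEnv-＠ E x i p) ⟩
  size t + (sizeEnv E + size i)               ≡⟨ +-assoc (size t) _ _ ⟨
  sizeProg (t , E) + size i                   ≡⟨ cong (_+ size i) (tight-program-size ft d iΘ) ⟩
  sizeCtx Θ + size i                          ≡⟨ cong (_+ size i) (sizeCtx-∖-⟨⟩ Θ x) ⟩
  sizeCtx (Θ ∖ x) + sizeM (Θ ⟨ x ⟩) + size i  ≡⟨ cong (λ n → sizeCtx (Θ ∖ x) + n + size i) (sizeM-≈ M≈Θx) ⟨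
  sizeCtx (Θ ∖ x) + sizeM M + size i          ≡⟨ xy∙z≈x∙zy (sizeCtx (Θ ∖ x)) (sizeM M) (size i) ⟩
  sizeCtx (Θ ∖ x) + (size i + sizeM M)        ≡⟨ cong (sizeCtx (Θ ∖ x) +_) Δ≡ ⟨
  sizeCtx (Θ ∖ x) + sizeCtx Δ                 ≡⟨ sizeCtx-++ (Θ ∖ x) Δ ⟨
  sizeCtx ((Θ ∖ x) ++ Δ)                      ∎
  where
  open ≡-Reasoning
  iΘ : InertCtx Θ
  iΘ = inertCtx-∖-⟨⟩ Θ x iΘ∖x (inertM-≈ M≈Θx iM)

record Redex (t : Term) : Set where
  constructor redex
  field
    C   : ECtx
    x   : Var
    s u : Term
    u-fireball : Fireball u
    t≡plug     : t ≡ plug C (app (lam x s) u)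

fireball-or-redex : (t : Term) → Fireball t ⊎ Redex t
fireball-or-redex (var x)   = inj₁ (fb-val val-var)
fireball-or-redex (lam x t) = inj₁ (fb-val val-lam)
fireball-or-redex (app t u) with fireball-or-redex u
... | inj₂ (redex C x s w fw refl) = inj₂ (redex (appL t C) x s w fw refl)
... | inj₁ fu with fireball-or-redex t
...   | inj₂ (redex C x s w fw refl)    = inj₂ (redex (appR C u fu) x s w fw refl)
...   | inj₁ (fb-val val-var)           = inj₁ (fb-inert (inert-var fu))
...   | inj₁ (fb-val (val-lam {x} {s})) = inj₂ (redex hole x s u fu refl)
...   | inj₁ (fb-inert it)              = inj₁ (fb-inert (inert-app it fu))

normal⇒fireball : ∀ {t E} → NormalProgram (t , E) → Fireball t
normal⇒fireball {t} normal with fireball-or-redex t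
... | inj₁ ft                                = ft
... | inj₂ (redex C x s u (fb-val v) refl)   = ⊥-elim (normal (_ , βv v))
... | inj₂ (redex C x s u (fb-inert i) refl) = ⊥-elim (normal (_ , βi i))

proposition11 : (e : Expr) (Γ : TCtx) → NormalExpr e →
    Γ ⊢ₑ e ∶ 𝟎 → InertCtx Γ → sizeExpr e ≡ sizeCtx Γ
proposition11 (term t) Γ normal d iΓ =
  sym (tight-fireball-size (normal⇒fireball (normal ε)) d iΓ)
proposition11 (prog (t , E)) Γ normal d iΓ = tight-program-size (normal⇒fireball normal) d iΓ
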